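{- Let $F$ be a figure with an equilibrium function $eq$ and let $\mathcal{H}_F$ be the associated set of height functions. For every $h,h'\in\mathcal{H}_F$ and every vertex $v\in V_F$ one has $h(v)-h'(v)\equiv 0 \pmod 4$. Moreover, for any two tilings $T,T'$ of $F$ and any $v\in V_F$, the quantity $h_T(v)-h_{T'}(v)$ does not depend on the choice of the equilibrium function $eq$.
   Context: Square grid $\Lambda$ with vertices $\mathbb{Z}^2$, unit edges, unit square cells coloured black/white as a checkerboard. A figure $F$ is a finite 4-connected union of cells. $H_\infty$ is the unbounded 8-connected component of $\mathbb{R}^2\setminus F$, the others being holes. Every vertex all of whose incident edges lie on the boundary of $F$ (two cells of $F$ meeting only at that corner) is replaced by two copies, each adjacent to the two neighbours lying on one of these cells. $G_F=(V_F,E_F)$: vertices are corners of cells of $F$ (after duplication), arcs are both orientations of each side of each cell of $F$; $E_b(F)$: arcs whose edge lies on the boundary of $F$; others are interior. For $g:E_F\to\mathbb{Z}$ and a path $P$, $g(P)$ is the sum of $g$ over arcs of $P$; $D(h)(v,v')=h(v')-h(v)$. Spin: $sp(v,v')=1$ if moving from $v$ to $v'$ there is a white cell on the left, $-1$ otherwise. For an elementary clockwise cycle $C$, $Dis_F(C)$ = (black cells of $F$ enclosed) $-$ (white cells of $F$ enclosed). An equilibrium function is a skew-symmetric $eq:E_F\to\mathbb{Z}$ with $sp(C)+eq(C)=4Dis_F(C)$ for every elementary clockwise cycle $C$ of $G_F$. $\mathbf{t}(a)=eq(a)-sp(a)+2$, $\mathbf{b}(a)=eq(a)-sp(a)-2$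 for interior arcs, $\mathbf{t}(a)=\mathbf{b}(a)=eq(a)+sp(a)$ for $a\in E_b(F)$. Fix $w_0\in V_F$ on the boundary of $H_\infty$. $\mathcal{H}_F$ is the set of $h:V_F\to\mathbb{Z}$ with $h(w_0)=0$ and $D(h)(a)\in\{\mathbf{b}(a),\mathbf{t}(a)\}$ for all $a\in E_F$. Dominoes, tilings: a tiling is a set of dominoes (two cells sharing an edge, the central axis) in $F$ with disjoint interiors covering $F$; $\chi_T(a)=1$ iff the edge of $a$ is a central axis of a domino of $T$; $g_T(a)=eq(a)-sp(a)+2sp(a)(1-2\chi_T(a))$; $h_T$ is the unique function with $h_T(w_0)=0$ and $D(h_T)=g_T$. -}

module Defs where

open import Data.Bool using (Bool; true; false; _∧_; _∨_; not; if_then_else_; _xor_)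
open import Data.Nat using (ℕ; zero; suc) renaming (_≤_ to _≤ℕ_)
open import Data.Integer using (ℤ; +_; -_; _+_; _-_; _*_; _<_)
import Data.Integer as Int
import Data.Integer.DivMod
import Data.Nat
open import Data.Product using (_×_; _,_; proj₁; proj₂)
open import Data.Product.Properties using (≡-dec)
open import Data.Sum using (_⊎_)
open import Data.Empty using (⊥)
open import Data.List using (List; []; _∷_; _++_; [_]; length; map; foldr)
open import Data.Bool.ListAction using (any)
open import Data.List.Relation.Unary.All using (All)
open import Data.List.Relation.Unary.Linked using (Linked)
open import Data.List.Relation.Unary.Unique.Propositional using (Unique)
open import Relation.Nullary.Decidable using (⌊_⌋; Dec)
open import Relation.Binary.PropositionalEquality using (_≡_)

Point : Set
Point = ℤ × ℤ

-- A unit cell, named by its lower-left corner (x , y): [x,x+1]×[y,y+1].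
Cell : Set
Cell = ℤ × ℤ

_≟P_ : (p q : Point) → Dec (p ≡ q)
_≟P_ = ≡-dec Int._≟_ Int._≟_

_==P_ : Point → Point → Bool
p ==P q = ⌊ p ≟P q ⌋

_+P_ : Point → Point → Point
(a , b) +P (c , d) = (a + c , b + d)

isWhite : Cell → Bool
isWhite (x , y) = ⌊ ((x + y) Int.%ℕ 2) Data.Nat.≟ 0 ⌋

colourSign : Cell → ℤ
colourSign c = if isWhite c then - (+ 1) else + 1

sumℤ : List ℤ → ℤ
sumℤ = foldr _+_ (+ 0)

-- A finite set of cells, given as a duplicate-free list.
Cells : Set
Cells = List Cell

_∈ᶜ_ : Cell → Cells → Bool
c ∈ᶜ F = any (λ d → c ==P d) F

data Dir : Set where
  E N W S : Dir

step : Dir → Point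
step E = (+ 1 , + 0)
step N = (+ 0 , + 1)
step W = (- (+ 1) , + 0)
step S = (+ 0 , - (+ 1))

opp : Dir → Dir
opp E = W
opp N = S
opp W = E
opp S = N

data Conn4 (F : Cells) : Cell → Cell → Set where
  here : ∀ {c} → Conn4 F c c
  next : ∀ {c d} (δ : Dir) → (c +P step δ) ∈ᶜ F ≡ true →
         Conn4 F (c +P step δ) d → Conn4 F c d

record Figure (F : Cells) : Set where
  field
    nonempty  : F ≡ [] → ⊥
    noDup     : Unique F
    connected : ∀ c d → c ∈ᶜ F ≡ true → d ∈ᶜ F ≡ true → Conn4 F c d

data Dir8 : Set where
  e ne n nw w sw s se : Dir8

step8 : Dir8 → Point
step8 e  = (+ 1 , + 0)
step8 ne = (+ 1 , + 1)
step8 n  = (+ 0 , + 1)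
step8 nw = (- (+ 1) , + 1)
step8 w  = (- (+ 1) , + 0)
step8 sw = (- (+ 1) , - (+ 1))
step8 s  = (+ 0 , - (+ 1))
step8 se = (+ 1 , - (+ 1))

-- c can be joined, through an 8-path of cells not in F, to a cell lying
-- strictly to the left of every cell of F (hence to infinity).
data ReachInf (F : Cells) : Cell → Set where
  far  : ∀ {c} → All (λ d → proj₁ c < proj₁ d) F → ReachInf F c
  next : ∀ {c} (δ : Dir8) → (c +P step8 δ) ∈ᶜ F ≡ false →
         ReachInf F (c +P step8 δ) → ReachInf F c

InHinf : Cells → Cell → Set
InHinf F c = (c ∈ᶜ F ≡ false) × ReachInf F c

cellNE cellNW cellSW cellSE : Point → Cell
cellNE (x , y) = (x , y)
cellNW (x , y) = (x - + 1 , y)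
cellSW (x , y) = (x - + 1 , y - + 1)
cellSE (x , y) = (x , y - + 1)

isCorner : Cells → Point → Bool
isCorner F p = cellNE p ∈ᶜ F ∨ cellNW p ∈ᶜ F ∨ cellSW p ∈ᶜ F ∨ cellSE p ∈ᶜ F

-- p is a vertex all of whose incident edges are on the boundary of F
-- while p is a corner of F: two cells of F meet only at p.
isDup : Cells → Point → Bool
isDup F p =
  (cellNE p ∈ᶜ F ∧ cellSW p ∈ᶜ F ∧ not (cellNW p ∈ᶜ F) ∧ not (cellSE p ∈ᶜ F)) ∨
  (cellNW p ∈ᶜ F ∧ cellSE p ∈ᶜ F ∧ not (cellNE p ∈ᶜ F) ∧ not (cellSW p ∈ᶜ F))

-- A candidate vertex: a point, plus a flag selecting the copy for
-- duplicated points (up = true: the copy attached to the cell of F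
-- lying above the point; up = false: the one attached to the cell below).
-- For non-duplicated points the flag is always false.
record Vtx : Set where
  constructor vtx
  field
    pt : Point
    up : Bool

InV : Cells → Vtx → Set
InV F (vtx p u) = (isCorner F p ∧ (isDup F p ∨ not u)) ≡ true

vertexAt : Cells → Point → Cell → Vtx
vertexAt F p c = vtx p (isDup F p ∧ ⌊ Int._≟_ (proj₂ c) (proj₂ p) ⌋)

Arc : Set
Arc = Point × Dir

headP : Arc → Point
headP (p , d) = p +P step d

rev : Arc → Arc
rev (p , d) = (p +P step d , opp d)

leftCell rightCell : Arc → Cell
leftCell  (p , E) = cellNE p
leftCell  (p , N) = cellNW p
leftCell  (p , W) = cellSW p
leftCell  (p , S) = cellSE p
rightCell (p , E) = cellSE p
rightCell (p , N) = cellNE p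
rightCell (p , W) = cellNW p
rightCell (p , S) = cellSW p

InE : Cells → Arc → Set
InE F a = (leftCell a ∈ᶜ F ∨ rightCell a ∈ᶜ F) ≡ true

isBoundary : Cells → Arc → Bool
isBoundary F a = leftCell a ∈ᶜ F xor rightCell a ∈ᶜ F

arcCell : Cells → Arc → Cell
arcCell F a = if leftCell a ∈ᶜ F then leftCell a else rightCell a

tailV headV : Cells → Arc → Vtx
tailV F a = vertexAt F (proj₁ a) (arcCell F a)
headV F a = vertexAt F (headP a) (arcCell F a)

D : Cells → (Vtx → ℤ) → Arc → ℤ
D F h a = h (headV F a) - h (tailV F a)

sp : Arc → ℤ
sp a = if isWhite (leftCell a) then + 1 else - (+ 1)

CycLinked : Cells → List Arc → Set
CycLinked F []       = ⊥
CycLinked F (a ∷ as) = Linked (λ x y → headV F x ≡ tailV F y) ((a ∷ as) ++ [ a ])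

-- contribution of an arc to the winding number around the centre of
-- cell (x , y), counted with the horizontal ray to the right
crossing : Cell → Arc → ℤ
crossing (x , y) ((px , py) , N) =
  if ⌊ Int._≟_ py y ⌋ ∧ ⌊ Int._<?_ x px ⌋ then + 1 else + 0
crossing (x , y) ((px , py) , S) =
  if ⌊ Int._≟_ py (y + + 1) ⌋ ∧ ⌊ Int._<?_ x px ⌋ then - (+ 1) else + 0
crossing c (_ , E) = + 0
crossing c (_ , W) = + 0

wind : List Arc → Cell → ℤ
wind C c = sumℤ (map (crossing c) C)

-- an elementary (simple) cycle of G_F, oriented clockwise
-- (winding number -1 around every enclosed cell, 0 elsewhere)
record ElemCWCycle (F : Cells) (C : List Arc) : Set where
  field
    arcs      : All (InE F) C
    long      : 3 ≤ℕ length C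
    closed    : CycLinked F C
    simple    : Unique (map (tailV F) C)
    clockwise : ∀ c → wind C c ≡ + 0 ⊎ wind C c ≡ - (+ 1)

-- Dis_F(C) = #black cells of F enclosed - #white cells of F enclosed
Dis : Cells → List Arc → ℤ
Dis F C = sumℤ (map (λ c → colourSign c * (- wind C c)) F)

sumArc : (Arc → ℤ) → List Arc → ℤ
sumArc g C = sumℤ (map g C)

record Equilibrium (F : Cells) (eq : Arc → ℤ) : Set where
  field
    skew    : ∀ a → InE F a → eq (rev a) ≡ - eq a
    balance : ∀ C → ElemCWCycle F C →
              sumArc sp C + sumArc eq C ≡ + 4 * Dis F C

tB tT : Cells → (Arc → ℤ) → Arc → ℤ
tT F eq a = if isBoundary F a then eq a + sp a else eq a - sp a + + 2
tB F eq a = if isBoundary F a then eq a + sp a else eq a - sp a - + 2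

OnBoundaryHinf : Cells → Vtx → Set
OnBoundaryHinf F w0 =
  InV F w0 ×
  (InHinf F (cellNE (Vtx.pt w0)) ⊎ InHinf F (cellNW (Vtx.pt w0)) ⊎
   InHinf F (cellSW (Vtx.pt w0)) ⊎ InHinf F (cellSE (Vtx.pt w0)))

IsHeight : Cells → (Arc → ℤ) → Vtx → (Vtx → ℤ) → Set
IsHeight F eq w0 h =
  (h w0 ≡ + 0) ×
  (∀ a → InE F a → D F h a ≡ tB F eq a ⊎ D F h a ≡ tT F eq a)

-- a domino: lower-left cell, and whether it is horizontal
Domino : Set
Domino = Cell × Bool

cell₁ cell₂ : Domino → Cell
cell₁ (c , _) = c
cell₂ (c , true)  = c +P (+ 1 , + 0)
cell₂ (c , false) = c +P (+ 0 , + 1)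

-- endpoints of the central axis
axis₁ axis₂ : Domino → Point
axis₁ ((x , y) , true)  = (x + + 1 , y)
axis₁ ((x , y) , false) = (x , y + + 1)
axis₂ ((x , y) , true)  = (x + + 1 , y + + 1)
axis₂ ((x , y) , false) = (x + + 1 , y + + 1)

covers : Cell → Domino → Bool
covers c δ = (c ==P cell₁ δ) ∨ (c ==P cell₂ δ)

countCover : Cell → List Domino → ℕ
countCover c []      = 0
countCover c (δ ∷ T) = if covers c δ then suc (countCover c T) else countCover c T

record Tiling (F : Cells) (T : List Domino) : Set where
  field
    inside : All (λ δ → (cell₁ δ ∈ᶜ F ∧ cell₂ δ ∈ᶜ F) ≡ true) T
    cover  : ∀ c → c ∈ᶜ F ≡ true → countCover c T ≡ 1

isAxisOf : Arc → Domino → Bool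
isAxisOf a δ =
  ((proj₁ a ==P axis₁ δ) ∧ (headP a ==P axis₂ δ)) ∨
  ((proj₁ a ==P axis₂ δ) ∧ (headP a ==P axis₁ δ))

χ : List Domino → Arc → ℤ
χ T a = if any (isAxisOf a) T then + 1 else + 0

gT : (Arc → ℤ) → List Domino → Arc → ℤ
gT eq T a = eq a - sp a + + 2 * sp a * (+ 1 - + 2 * χ T a)

IsHT : Cells → (Arc → ℤ) → Vtx → List Domino → (Vtx → ℤ) → Set
IsHT F eq w0 T h = (h w0 ≡ + 0) × (∀ a → InE F a → D F h a ≡ gT eq T a)

{-# OPTIONS --safe #-}

-- The graph G_F is connected: every vertex of V_F is a corner of some cell of F (for a
-- duplicated point, the upper copy is a corner of the cell above it and the lower copy of
-- the cell below), the corners of a cell are joined by its sides, and 4-adjacent cells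
-- share a vertex. Along every arc both D(h) and D(h') take one of the values b, t, and
-- t - b is 0 or 4, so h - h' is constant modulo 4 on G_F; it vanishes at w0. For tilings,
-- g_T - g_T' does not involve eq, so (h_T - h_T') for eq₁ minus (h_T - h_T') for eq₂ has
-- zero increments, hence is constant, and it vanishes at w0.

module Submission where

open import Defs
open import Data.Integer using (ℤ; +_; _-_)
open import Data.Integer.Divisibility using (_∣_)
open import Data.Product using (_×_)
open import Data.List using (List)
open import Relation.Binary.PropositionalEquality using (_≡_)

open import Data.Bool using (Bool; true; false; _∧_; _∨_)
open import Data.Bool.Properties using (∨-zeroʳ)
open import Data.Integer using (_+_; _*_; -_; _≟_)
open import Data.Integer.Properties
  using (+-identityʳ; +-inverseʳ; *-zeroˡ; i≢suc[i]; i-j≡0⇒i≡j)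
open import Data.Integer.Divisibility.Signed as Signed
  using (divides; ∣m⇒∣-m; ∣m∣n⇒∣m+n; ∣⇒∣ᵤ)
open import Data.Integer.Tactic.RingSolver using (solve-∀)
open import Data.Product using (Σ; _,_; proj₂)
open import Data.Sum using (_⊎_; inj₁; inj₂)
open import Level using (0ℓ)
open import Relation.Binary.Bundles using (Setoid)
open import Relation.Binary.Core using (Rel)
open import Relation.Binary.Structures using (IsEquivalence)
import Relation.Binary.Reasoning.Setoid as SetoidReasoning
open import Relation.Binary.Construct.Closure.ReflexiveTransitive using (_◅◅_)
open import Relation.Binary.Construct.Closure.Equivalence as EqClosure using (EqClosure)
open import Relation.Binary.PropositionalEquality
  using (_≢_; refl; sym; trans; cong; cong₂; subst; setoid; module ≡-Reasoning)
open import Relation.Nullary.Decidable using (⌊_⌋; does; isYes≗does; dec-true; dec-false)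

i-1+1≡i : ∀ i → (i - + 1) + + 1 ≡ i
i-1+1≡i = solve-∀

i+1-1≡i : ∀ i → (i + + 1) - + 1 ≡ i
i+1-1≡i = solve-∀

i-1≢i : ∀ i → i - + 1 ≢ i
i-1≢i i i-1≡i = i≢suc[i] (trans i-1≡i (sym (1+[i-1]≡i i)))
  where
  1+[i-1]≡i : ∀ i → + 1 + (i - + 1) ≡ i
  1+[i-1]≡i = solve-∀

ModEq : ℤ → Rel ℤ 0ℓ
ModEq m x y = m Signed.∣ (y - x)

modEq-isEquivalence : ∀ m → IsEquivalence (ModEq m)
modEq-isEquivalence m = record
  { refl  = λ {x} → divides (+ 0) (trans (+-inverseʳ x) (sym (*-zeroˡ m)))
  ; sym   = λ {x} {y} m∣y-x → subst (m Signed.∣_) (negate-difference x y) (∣m⇒∣-m m∣y-x)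
  ; trans = λ {x} {y} {z} m∣y-x m∣z-y →
      subst (m Signed.∣_) (telescope x y z) (∣m∣n⇒∣m+n m∣z-y m∣y-x)
  }
  where
  negate-difference : ∀ x y → - (y - x) ≡ x - y
  negate-difference = solve-∀
  telescope : ∀ x y z → (z - y) + (y - x) ≡ z - x
  telescope = solve-∀

modEq-setoid : ℤ → Setoid 0ℓ 0ℓ
modEq-setoid m = record { isEquivalence = modEq-isEquivalence m }

module _ (X : Setoid 0ℓ 0ℓ) where
  open Setoid X using (_≈_) renaming (refl to ≈-refl; sym to ≈-sym)

  congruent-choices : ∀ {b t x y} → b ≈ t →
    x ≡ b ⊎ x ≡ t → y ≡ b ⊎ y ≡ t → x ≈ y
  congruent-choices b≈t (inj₁ refl) (inj₁ refl) = ≈-refl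
  congruent-choices b≈t (inj₁ refl) (inj₂ refl) = b≈t
  congruent-choices b≈t (inj₂ refl) (inj₁ refl) = ≈-sym b≈t
  congruent-choices b≈t (inj₂ refl) (inj₂ refl) = ≈-refl

data Adjacent (F : Cells) (u v : Vtx) : Set where
  arc : ∀ a → InE F a → tailV F a ≡ u → headV F a ≡ v → Adjacent F u v

Connected : Cells → Rel Vtx 0ℓ
Connected F = EqClosure (Adjacent F)

invariant-on-connected : ∀ {F} (X : Setoid 0ℓ 0ℓ) (f : Vtx → Setoid.Carrier X) →
  (∀ a → InE F a → Setoid._≈_ X (f (tailV F a)) (f (headV F a))) →
  ∀ {u v} → Connected F u v → Setoid._≈_ X (f u) (f v)
invariant-on-connected X f invariant =
  EqClosure.gfold (Setoid.isEquivalence X) f λ { (arc a a∈E refl refl) → invariant a a∈E }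

data Quadrant : Set where
  NE NW SW SE : Quadrant

quadrant : Quadrant → Point → Cell
quadrant NE = cellNE
quadrant NW = cellNW
quadrant SW = cellSW
quadrant SE = cellSE

isAbove : Quadrant → Bool
isAbove NE = true
isAbove NW = true
isAbove SW = false
isAbove SE = false

cornerOf : Quadrant → Cell → Point
cornerOf NE c = c
cornerOf NW c = c +P step E
cornerOf SW c = (c +P step E) +P step N
cornerOf SE c = c +P step N

cornerOf-quadrant : ∀ q p → cornerOf q (quadrant q p) ≡ p
cornerOf-quadrant NE p       = refl
cornerOf-quadrant NW (x , y) = cong₂ _,_ (i-1+1≡i x) (+-identityʳ y)
cornerOf-quadrant SW (x , y) =
  cong₂ _,_ (trans (+-identityʳ _) (i-1+1≡i x))
            (trans (cong (_+ + 1) (+-identityʳ (y - + 1))) (i-1+1≡i y))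
cornerOf-quadrant SE (x , y) = cong₂ _,_ (+-identityʳ x) (i-1+1≡i y)

quadrant-cornerOf : ∀ q c → quadrant q (cornerOf q c) ≡ c
quadrant-cornerOf NE c       = refl
quadrant-cornerOf NW (x , y) = cong₂ _,_ (i+1-1≡i x) (+-identityʳ y)
quadrant-cornerOf SW (x , y) =
  cong₂ _,_ (trans (cong (_- + 1) (+-identityʳ (x + + 1))) (i+1-1≡i x))
            (trans (cong (λ z → (z + + 1) - + 1) (+-identityʳ y)) (i+1-1≡i y))
quadrant-cornerOf SE (x , y) = cong₂ _,_ (+-identityʳ x) (i+1-1≡i y)

step-opp : ∀ c δ → (c +P step δ) +P step (opp δ) ≡ c
step-opp (x , y) E = cong₂ _,_ (i+1-1≡i x) (trans (+-identityʳ _) (+-identityʳ y))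
step-opp (x , y) N = cong₂ _,_ (trans (+-identityʳ _) (+-identityʳ x)) (i+1-1≡i y)
step-opp (x , y) W = cong₂ _,_ (i-1+1≡i x) (trans (+-identityʳ _) (+-identityʳ y))
step-opp (x , y) S = cong₂ _,_ (trans (+-identityʳ _) (+-identityʳ x)) (i-1+1≡i y)

row-quadrant : ∀ q p → ⌊ proj₂ (quadrant q p) ≟ proj₂ p ⌋ ≡ isAbove q
row-quadrant q (x , y) = trans (isYes≗does (proj₂ (quadrant q (x , y)) ≟ y)) (does-row q)
  where
  does-row : ∀ q → does (proj₂ (quadrant q (x , y)) ≟ y) ≡ isAbove q
  does-row NE = dec-true (y ≟ y) refl
  does-row NW = dec-true (y ≟ y) refl
  does-row SW = dec-false (y - + 1 ≟ y) (i-1≢i y)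
  does-row SE = dec-false (y - + 1 ≟ y) (i-1≢i y)

module _ {F : Cells} where

  isCorner-quadrant : ∀ {p} → isCorner F p ≡ true →
    Σ Quadrant λ q → quadrant q p ∈ᶜ F ≡ true
  isCorner-quadrant {p} corner
    with cellNE p ∈ᶜ F in ne∈F | cellNW p ∈ᶜ F in nw∈F
       | cellSW p ∈ᶜ F in sw∈F | cellSE p ∈ᶜ F in se∈F
  ... | true  | _     | _     | _    = NE , ne∈F
  ... | false | true  | _     | _    = NW , nw∈F
  ... | false | false | true  | _    = SW , sw∈F
  ... | false | false | false | true = SE , se∈F

  isDup-diagonal : ∀ {p} → isDup F p ≡ true →
    (cellNE p ∈ᶜ F ≡ true × cellSW p ∈ᶜ F ≡ true) ⊎
    (cellNW p ∈ᶜ F ≡ true × cellSE p ∈ᶜ F ≡ true)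
  isDup-diagonal {p} dup
    with cellNE p ∈ᶜ F | cellSW p ∈ᶜ F | cellNW p ∈ᶜ F | cellSE p ∈ᶜ F
  ... | true  | true  | _     | _    = inj₁ (refl , refl)
  ... | false | _     | true  | true = inj₂ (refl , refl)
  ... | true  | false | true  | true  with () ← dup
  ... | true  | false | true  | false with () ← dup
  ... | true  | false | false | _     with () ← dup

  isDup-vertical : ∀ {p} → cellNE p ∈ᶜ F ≡ true → cellSE p ∈ᶜ F ≡ true →
    isDup F p ≡ false
  isDup-vertical {p} ne∈F se∈F rewrite ne∈F | se∈F with cellNW p ∈ᶜ F | cellSW p ∈ᶜ F
  ... | true  | true  = refl
  ... | true  | false = refl
  ... | false | true  = refl
  ... | false | false = refl

  vertex-quadrant : ∀ {p u} → InV F (vtx p u) →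
    Σ Quadrant λ q → quadrant q p ∈ᶜ F ≡ true × u ≡ isDup F p ∧ isAbove q
  vertex-quadrant {p} {u} v∈V with isCorner F p in corner | isDup F p in dup | u
  ... | true | true | true with isDup-diagonal dup
  ...   | inj₁ (ne∈F , _) = NE , ne∈F , refl
  ...   | inj₂ (nw∈F , _) = NW , nw∈F , refl
  vertex-quadrant v∈V | true | true | false with isDup-diagonal dup
  ...   | inj₁ (_ , sw∈F) = SW , sw∈F , refl
  ...   | inj₂ (_ , se∈F) = SE , se∈F , refl
  vertex-quadrant v∈V | true | false | false =
    let q , q∈F = isCorner-quadrant corner in q , q∈F , refl

  ∈ᶜ-resp-≡ : ∀ {c d} → c ≡ d → c ∈ᶜ F ≡ true → d ∈ᶜ F ≡ true
  ∈ᶜ-resp-≡ refl c∈F = c∈F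

  anchor : Cell → Vtx
  anchor c = vertexAt F c c

  along : ∀ {u v} a → InE F a → tailV F a ≡ u → headV F a ≡ v → Connected F u v
  along a a∈E tail≡u head≡v = EqClosure.return (arc a a∈E tail≡u head≡v)

  vertexAt-row : ∀ p (c d : Cell) → proj₂ c ≡ proj₂ d → vertexAt F p c ≡ vertexAt F p d
  vertexAt-row p c d row = cong (λ y → vtx p (isDup F p ∧ ⌊ y ≟ proj₂ p ⌋)) row

  vertexAt-undup : ∀ {p} (c d : Cell) → isDup F p ≡ false → vertexAt F p c ≡ vertexAt F p d
  vertexAt-undup {p} c d undup = cong (vtx p) (begin
    isDup F p ∧ ⌊ proj₂ c ≟ proj₂ p ⌋
      ≡⟨ cong (_∧ ⌊ proj₂ c ≟ proj₂ p ⌋) undup ⟩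
    false
      ≡⟨ cong (_∧ ⌊ proj₂ d ≟ proj₂ p ⌋) undup ⟨
    isDup F p ∧ ⌊ proj₂ d ≟ proj₂ p ⌋
      ∎)
    where open ≡-Reasoning

  inE-left : ∀ a → leftCell a ∈ᶜ F ≡ true → InE F a
  inE-left a left∈F = cong (_∨ rightCell a ∈ᶜ F) left∈F

  inE-right : ∀ a → rightCell a ∈ᶜ F ≡ true → InE F a
  inE-right a right∈F =
    trans (cong (leftCell a ∈ᶜ F ∨_) right∈F) (∨-zeroʳ (leftCell a ∈ᶜ F))

  arcCell-left : ∀ a → leftCell a ∈ᶜ F ≡ true → arcCell F a ≡ leftCell a
  arcCell-left a left∈F rewrite left∈F = refl

  arcCell-vertical-row : ∀ q → proj₂ (arcCell F (q , N)) ≡ proj₂ q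
  arcCell-vertical-row q with cellNW q ∈ᶜ F
  ... | true  = refl
  ... | false = refl

  bottom-side : ∀ {c} → c ∈ᶜ F ≡ true → Connected F (anchor c) (vertexAt F (c +P step E) c)
  bottom-side {c} c∈F =
    along (c , E) (inE-left (c , E) c∈F) (cong (vertexAt F c) arcCell≡c)
                                         (cong (vertexAt F (c +P step E)) arcCell≡c)
    where
    arcCell≡c : arcCell F (c , E) ≡ c
    arcCell≡c = arcCell-left (c , E) c∈F

  vertical-side : ∀ {q} c → InE F (q , N) → proj₂ c ≡ proj₂ q →
    Connected F (vertexAt F q c) (vertexAt F (q +P step N) c)
  vertical-side {q} c q∈E row =
    along (q , N) q∈E (vertexAt-row q cell c same-row) (vertexAt-row (q +P step N) cell c same-row)
    where
    cell : Cell
    cell = arcCell F (q , N)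
    same-row : proj₂ cell ≡ proj₂ c
    same-row = trans (arcCell-vertical-row q) (sym row)

  corners-connected : ∀ {c} → c ∈ᶜ F ≡ true → ∀ q →
    Connected F (anchor c) (vertexAt F (cornerOf q c) c)
  corners-connected c∈F NE = EqClosure.reflexive (Adjacent F)
  corners-connected c∈F NW = bottom-side c∈F
  corners-connected {c} c∈F SE = vertical-side c (inE-right (c , N) c∈F) refl
  corners-connected {c} c∈F SW =
    bottom-side c∈F ◅◅
    vertical-side c (inE-left (c +P step E , N) west∈F) (sym (+-identityʳ (proj₂ c)))
    where
    west∈F : cellNW (c +P step E) ∈ᶜ F ≡ true
    west∈F = ∈ᶜ-resp-≡ (sym (quadrant-cornerOf NW c)) c∈F

  open SetoidReasoning (EqClosure.setoid (Adjacent F))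

  east-connected : ∀ {c} → c ∈ᶜ F ≡ true → Connected F (anchor c) (anchor (c +P step E))
  east-connected {c} c∈F = begin
    anchor c                    ≈⟨ corners-connected c∈F NW ⟩
    vertexAt F (c +P step E) c  ≡⟨ vertexAt-row _ c (c +P step E) (sym (+-identityʳ (proj₂ c))) ⟩
    anchor (c +P step E)        ∎

  north-connected : ∀ {c} → c ∈ᶜ F ≡ true → (c +P step N) ∈ᶜ F ≡ true →
    Connected F (anchor c) (anchor (c +P step N))
  north-connected {c} c∈F north∈F = begin
    anchor c                    ≈⟨ corners-connected c∈F SE ⟩
    vertexAt F (c +P step N) c  ≡⟨ vertexAt-undup c (c +P step N) (isDup-vertical north∈F below∈F) ⟩
    anchor (c +P step N)        ∎
    where
    below∈F : cellSE (c +P step N) ∈ᶜ F ≡ true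
    below∈F = ∈ᶜ-resp-≡ (sym (quadrant-cornerOf SE c)) c∈F

  neighbours-connected : ∀ {c} δ → c ∈ᶜ F ≡ true → (c +P step δ) ∈ᶜ F ≡ true →
    Connected F (anchor c) (anchor (c +P step δ))
  neighbours-connected E c∈F _       = east-connected c∈F
  neighbours-connected N c∈F north∈F = north-connected c∈F north∈F
  neighbours-connected {c} W c∈F west∈F = begin
    anchor c                          ≡⟨ cong anchor (step-opp c W) ⟨
    anchor ((c +P step W) +P step E)  ≈⟨ east-connected west∈F ⟨
    anchor (c +P step W)              ∎
  neighbours-connected {c} S c∈F south∈F = begin
    anchor c                          ≡⟨ cong anchor (step-opp c S) ⟨
    anchor ((c +P step S) +P step N)  ≈⟨ north-connected south∈F north∈F ⟨
    anchor (c +P step S)              ∎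
    where
    north∈F : ((c +P step S) +P step N) ∈ᶜ F ≡ true
    north∈F = ∈ᶜ-resp-≡ (sym (step-opp c S)) c∈F

  vertex-on-cell : ∀ {v} → InV F v →
    Σ Cell λ c → c ∈ᶜ F ≡ true × Connected F (anchor c) v
  vertex-on-cell {vtx p u} v∈V =
    let q , c∈F , u≡flag = vertex-quadrant v∈V
        c = quadrant q p
    in c , c∈F , (begin
      anchor c                       ≈⟨ corners-connected c∈F q ⟩
      vertexAt F (cornerOf q c) c    ≡⟨ cong (λ x → vertexAt F x c) (cornerOf-quadrant q p) ⟩
      vertexAt F p c                 ≡⟨ cong (λ b → vtx p (isDup F p ∧ b)) (row-quadrant q p) ⟩
      vtx p (isDup F p ∧ isAbove q)  ≡⟨ cong (vtx p) u≡flag ⟨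
      vtx p u                        ∎)

  cells-connected : ∀ {c d} → Conn4 F c d → c ∈ᶜ F ≡ true →
    Connected F (anchor c) (anchor d)
  cells-connected here              c∈F = EqClosure.reflexive (Adjacent F)
  cells-connected (next δ c'∈F path) c∈F =
    neighbours-connected δ c∈F c'∈F ◅◅ cells-connected path c'∈F

  figure-connected : Figure F → ∀ {u v} → InV F u → InV F v → Connected F u v
  figure-connected figure {u} {v} u∈V v∈V =
    let c , c∈F , c~u = vertex-on-cell u∈V
        d , d∈F , d~v = vertex-on-cell v∈V
    in begin
      u         ≈⟨ c~u ⟨
      anchor c  ≈⟨ cells-connected (Figure.connected figure c d c∈F d∈F) c∈F ⟩
      anchor d  ≈⟨ d~v ⟩
      v         ∎

D-sub : ∀ F (h h' : Vtx → ℤ) a → D F (λ v → h v - h' v) a ≡ D F h a - D F h' a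
D-sub F h h' a = interchange (h (headV F a)) (h' (headV F a)) (h (tailV F a)) (h' (tailV F a))
  where
  interchange : ∀ w x y z → (w - x) - (y - z) ≡ (w - y) - (x - z)
  interchange = solve-∀

tB≡tT-mod-4 : ∀ F eq a → ModEq (+ 4) (tB F eq a) (tT F eq a)
tB≡tT-mod-4 F eq a with isBoundary F a
... | true  = IsEquivalence.refl (modEq-isEquivalence (+ 4)) {eq a + sp a}
... | false = divides (+ 1) (gap (eq a) (sp a))
  where
  gap : ∀ e s → (e - s + + 2) - (e - s - + 2) ≡ + 1 * + 4
  gap = solve-∀

gT-difference : ∀ eq₁ eq₂ T T' a → gT eq₁ T a - gT eq₁ T' a ≡ gT eq₂ T a - gT eq₂ T' a
gT-difference eq₁ eq₂ T T' a = eq-cancels (eq₁ a) (eq₂ a) (sp a) (χ T a) (χ T' a)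
  where
  eq-cancels : ∀ e₁ e₂ s x x' →
    (e₁ - s + + 2 * s * (+ 1 - + 2 * x)) - (e₁ - s + + 2 * s * (+ 1 - + 2 * x')) ≡
    (e₂ - s + + 2 * s * (+ 1 - + 2 * x)) - (e₂ - s + + 2 * s * (+ 1 - + 2 * x'))
  eq-cancels = solve-∀

module _ {F : Cells} {w0 : Vtx} (figure : Figure F) (w0∈V : InV F w0) where

  heights-congruent-mod-4 : ∀ eq h h' → IsHeight F eq w0 h → IsHeight F eq w0 h' →
    ∀ v → InV F v → + 4 ∣ (h v - h' v)
  heights-congruent-mod-4 eq h h' (h₀ , hD) (h'₀ , h'D) v v∈V =
    ∣⇒∣ᵤ (subst (+ 4 Signed.∣_) f[v]-f[w0]≈f[v] f[w0]≈f[v])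
    where
    f : Vtx → ℤ
    f u = h u - h' u
    arc-step : ∀ a → InE F a → ModEq (+ 4) (f (tailV F a)) (f (headV F a))
    arc-step a a∈E = subst (+ 4 Signed.∣_) (sym (D-sub F h h' a))
      (congruent-choices (modEq-setoid (+ 4)) (tB≡tT-mod-4 F eq a) (h'D a a∈E) (hD a a∈E))
    f[w0]≈f[v] : ModEq (+ 4) (f w0) (f v)
    f[w0]≈f[v] =
      invariant-on-connected (modEq-setoid (+ 4)) f arc-step (figure-connected figure w0∈V v∈V)
    f[v]-f[w0]≈f[v] : f v - f w0 ≡ f v
    f[v]-f[w0]≈f[v] = trans (cong (λ z → f v - z) (cong₂ _-_ h₀ h'₀)) (+-identityʳ (f v))

  tiling-height-differences-agree : ∀ T T' eq₁ eq₂ hT₁ hT'₁ hT₂ hT'₂ →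
    IsHT F eq₁ w0 T hT₁ → IsHT F eq₁ w0 T' hT'₁ →
    IsHT F eq₂ w0 T hT₂ → IsHT F eq₂ w0 T' hT'₂ →
    ∀ v → InV F v → hT₁ v - hT'₁ v ≡ hT₂ v - hT'₂ v
  tiling-height-differences-agree T T' eq₁ eq₂ A A' B B'
    (A₀ , AD) (A'₀ , A'D) (B₀ , BD) (B'₀ , B'D) v v∈V =
    i-j≡0⇒i≡j _ _ (begin
      f v   ≡⟨ invariant-on-connected (setoid ℤ) f arc-step (figure-connected figure w0∈V v∈V) ⟨
      f w0  ≡⟨ cong₂ _-_ (cong₂ _-_ A₀ A'₀) (cong₂ _-_ B₀ B'₀) ⟩
      + 0   ∎)
    where
    open ≡-Reasoning
    f : Vtx → ℤ
    f u = (A u - A' u) - (B u - B' u)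
    increment : ∀ a → InE F a → D F f a ≡ + 0
    increment a a∈E = begin
      D F f a
        ≡⟨ D-sub F (λ u → A u - A' u) (λ u → B u - B' u) a ⟩
      D F (λ u → A u - A' u) a - D F (λ u → B u - B' u) a
        ≡⟨ cong₂ _-_ (D-sub F A A' a) (D-sub F B B' a) ⟩
      (D F A a - D F A' a) - (D F B a - D F B' a)
        ≡⟨ cong₂ _-_ (cong₂ _-_ (AD a a∈E) (A'D a a∈E))
                     (cong₂ _-_ (BD a a∈E) (B'D a a∈E)) ⟩
      (gT eq₁ T a - gT eq₁ T' a) - (gT eq₂ T a - gT eq₂ T' a)
        ≡⟨ cong (_- (gT eq₂ T a - gT eq₂ T' a)) (gT-difference eq₁ eq₂ T T' a) ⟩
      (gT eq₂ T a - gT eq₂ T' a) - (gT eq₂ T a - gT eq₂ T' a)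
        ≡⟨ +-inverseʳ (gT eq₂ T a - gT eq₂ T' a) ⟩
      + 0 ∎
    arc-step : ∀ a → InE F a → f (tailV F a) ≡ f (headV F a)
    arc-step a a∈E = sym (i-j≡0⇒i≡j _ _ (increment a a∈E))

mainTheorem3 : (F : Cells) → Figure F → (w0 : Vtx) → OnBoundaryHinf F w0 →
    ((eq : Arc → ℤ) → Equilibrium F eq →
      (h h' : Vtx → ℤ) → IsHeight F eq w0 h → IsHeight F eq w0 h' →
      (v : Vtx) → InV F v → + 4 ∣ (h v - h' v))
    ×
    ((T T' : List Domino) → Tiling F T → Tiling F T' →
      (eq₁ eq₂ : Arc → ℤ) → Equilibrium F eq₁ → Equilibrium F eq₂ →
      (hT₁ hT'₁ hT₂ hT'₂ : Vtx → ℤ) →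
      IsHT F eq₁ w0 T hT₁ → IsHT F eq₁ w0 T' hT'₁ →
      IsHT F eq₂ w0 T hT₂ → IsHT F eq₂ w0 T' hT'₂ →
      (v : Vtx) → InV F v → hT₁ v - hT'₁ v ≡ hT₂ v - hT'₂ v)
mainTheorem3 F figure w0 (w0∈V , _) =
    (λ eq _ → heights-congruent-mod-4 figure w0∈V eq)
  , (λ T T' _ _ eq₁ eq₂ _ _ → tiling-height-differences-agree figure w0∈V T T' eq₁ eq₂)
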